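{- Let $T$ be a set of basic terms, $\kappa$ a time variable, and $\Delta$ the saturation of the sample set $\{t[\kappa]\mid t\in T\}$. Then for any valuation $\theta$ and any $p\in\overline{\omega}$, there exists a $\Delta$-diagram $\delta$ such that $\delta(\kappa)=p$ and $\delta(t[\kappa])=[\![t]\!]_\theta(p)$ for all $t\in T$.
   Context: Let $\overline{\omega}=\omega\cup\{\omega\}$ with its natural order. A time warp is a function $f:\overline{\omega}\to\overline{\omega}$ preserving all suprema (equivalently monotone with $f(0)=0$ and $f(\omega)=\bigvee_{n\in\omega}f(n)$); $fg:=f\circ g$; $\mathrm{id}$ is the identity; $\bot$ is constant $0$; $\top$ maps $0\mapsto0$, $p\mapsto\omega$ for $p\ne0$; the residuals satisfy $f\le h/g\iff fg\le h\iff g\le f\backslash h$ (pointwise order); $f^{\ell}:=\mathrm{id}/f$, $f^{r}:=f\backslash\mathrm{id}$, $f^{o}:=\top\backslash f$. Basic terms: $t,u::=x\mid tu\mid t^{o}\mid t^{\ell}\mid t^{r}\mid\mathrm{id}\mid\bot$ ($x$ a term variable). A valuation $\theta$ assigns a time warp to each term variable; $[\![t]\!]_\theta$ is defined by $[\![x]\!]_\theta=\theta(x)$, $[\![tu]\!]_\theta=[\![t]\!]_\theta[\![u]\!]_\theta$, $[\![t^{\star}]\!]_\theta=([\![t]\!]_\theta)^{\star}$ for $\star\in\{o,\ell,r\}$, $[\![\mathrm{id}]\!]_\theta=\mathrm{id}$, $[\![\bot]\!]_\theta=\bot$. Samples: $\alpha::=\kappa\mid t[\alpha]\mid\mathsf{s}(\alpha)\mid\mathsf{p}(\alpha)\mid\mathsf{last}(t)$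 with $\kappa$ a time variable and $t$ a basic term. The relation $\leadsto$: $t[\alpha]\leadsto\alpha$; $\mathsf{s}(\alpha)\leadsto\alpha$; $\mathsf{p}(\alpha)\leadsto\alpha$; $(tu)[\alpha]\leadsto t[u[\alpha]]$; $t^{o}[\alpha]\leadsto t[\alpha]$; $t^{r}[\alpha]\leadsto t[t^{r}[\alpha]],\ t[\mathsf{s}(t^{r}[\alpha])]$; $t^{\ell}[\alpha]\leadsto t[t^{\ell}[\alpha]],\ t[\mathsf{p}(t^{\ell}[\alpha])]$; $t[\alpha]\leadsto t[\mathsf{last}(t)]$. The saturation of a sample set is its closure under $\leadsto^*$; $\Delta$ is saturated if it equals its saturation. For $p\in\overline{\omega}$: $p\ominus1=p-1$ if $p\in\omega\setminus\{0\}$, else $p$; $p\oplus1=p+1$ if $p\in\omega$, else $p$. For a saturated sample set $\Delta$, a $\Delta$-diagram is a map $\delta:\Delta\to\overline{\omega}$ such that, for all samples mentioned lying in $\Delta$: (1) $\delta(\alpha)\le\delta(\beta)\Rightarrow\delta(t[\alpha])\le\delta(t[\beta])$; (2) $\delta(\alpha)=0\Rightarrow\delta(t[\alpha])=0$; (3) $\delta(\mathsf{p}(\alpha))=\delta(\alpha)\ominus1$; (4) $\delta(\mathsf{s}(\alpha))=\delta(\alpha)\oplus1$; (5) for $t[\alpha]\in\Delta$: $\delta(\mathsf{last}(t))\le\delta(\alpha)\iff\delta(t[\alpha])=\delta(t[\mathsf{last}(t)])$; (6) $\delta(\mathsf{last}(t))=\omega\Rightarrow\delta(t[\mathsf{last}(t)])=\omega$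 for $t[\mathsf{last}(t)]\in\Delta$; (7) $\delta(\mathrm{id}[\alpha])=\delta(\alpha)$; (8) if $\bot[\alpha]\in\Delta$ then $\delta(\mathsf{last}(\bot))=0$; (9) $\delta((tu)[\alpha])=\delta(t[u[\alpha]])$; (10) for $(tu)[\mathsf{last}(tu)]\in\Delta$: $\delta(\mathsf{last}(tu))=\omega\Rightarrow\delta(\mathsf{last}(t))=\delta(\mathsf{last}(u))=\omega$; (11) $\delta(t^{o}[\alpha])\in\{0,\omega\}$; (12) $\delta(\alpha)<\omega\Rightarrow(\delta(t^{o}[\alpha])=\omega\iff\delta(t[\alpha])=\omega)$; (13) $\delta(\mathsf{last}(t^{o}))<\omega$; (14) for $t[\alpha],t^{o}[\mathsf{last}(t^{o})]\in\Delta$: $\delta(t^{o}[\mathsf{last}(t^{o})])<\omega$ and $\delta(\alpha)<\omega$ imply $\delta(t[\alpha])<\omega$; (15) $\delta(t[t^{r}[\alpha]])\le\delta(\alpha)$; (16) for $t^{r}[\alpha]\in\Delta$: $0<\delta(\alpha)<\omega$ and $\delta(t^{r}[\alpha])<\omega$ imply $\delta(\alpha)<\delta(t[\mathsf{s}(t^{r}[\alpha])])$; (17) for $t^{r}[\mathsf{last}(t^{r})]\in\Delta$: $\delta(\mathsf{last}(t^{r}))=\omega\Rightarrow\delta(\mathsf{last}(t))=\omega$; (18) for $t^{r}[\mathsf{last}(t^{r})]\in\Delta$: $\delta(t^{r}[\mathsf{last}(t^{r})])<\omega\Rightarrow\delta(t[\mathsf{s}(t^{r}[\mathsf{last}(t^{r})])])=\omega$;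 (19) for $t[t^{\ell}[\alpha]]\in\Delta$: $\delta(t^{\ell}[\alpha])<\omega\Rightarrow\delta(\alpha)\le\delta(t[t^{\ell}[\alpha]])$; (20) for $t^{\ell}[\alpha]\in\Delta$: $0<\delta(\alpha)<\omega$ and $\delta(t^{\ell}[\alpha])<\omega$ imply $\delta(t[\mathsf{p}(t^{\ell}[\alpha])])<\delta(\alpha)$; (21) for $t[t^{\ell}[\alpha]]\in\Delta$: $\delta(\alpha)<\omega$ and $\delta(t^{\ell}[\alpha])=\omega$ imply $\delta(t[t^{\ell}[\alpha]])<\delta(\alpha)$; (22) for $t^{\ell}[\mathsf{last}(t^{\ell})]\in\Delta$: $\delta(\mathsf{last}(t^{\ell}))=\omega\Rightarrow\delta(\mathsf{last}(t))=\omega$; (23) for $t^{\ell}[\mathsf{last}(t^{\ell})]\in\Delta$: $\delta(t^{\ell}[\mathsf{last}(t^{\ell})])<\omega\Rightarrow\delta(t[t^{\ell}[\mathsf{last}(t^{\ell})]])=\omega$. -}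

module Defs where

open import Data.Nat using (ℕ; zero; suc; pred) renaming (_≤_ to _≤ℕ_; _<_ to _<ℕ_)
open import Data.Product using (Σ; _×_; _,_)
open import Data.Sum using (_⊎_)
open import Relation.Binary.PropositionalEquality using (_≡_)
open import Function.Bundles using (_⇔_)

data Ω : Set where
  fin : ℕ → Ω
  ω   : Ω

infix 4 _≤Ω_ _<Ω_

data _≤Ω_ : Ω → Ω → Set where
  fin≤fin : ∀ {m n} → m ≤ℕ n → fin m ≤Ω fin n
  ≤ω      : ∀ {p} → p ≤Ω ω

data _<Ω_ : Ω → Ω → Set where
  fin<fin : ∀ {m n} → m <ℕ n → fin m <Ω fin n
  fin<ω   : ∀ {m} → fin m <Ω ω

_⊖1 : Ω → Ω
fin n ⊖1 = fin (pred n)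
ω ⊖1 = ω

_⊕1 : Ω → Ω
fin n ⊕1 = fin (suc n)
ω ⊕1 = ω

record TimeWarp : Set where
  field
    fun   : Ω → Ω
    mono  : ∀ {p q} → p ≤Ω q → fun p ≤Ω fun q
    zero0 : fun (fin 0) ≡ fin 0
    supUB : ∀ n → fun (fin n) ≤Ω fun ω
    supLeast : ∀ q → (∀ n → fun (fin n) ≤Ω q) → fun ω ≤Ω q
open TimeWarp public

_≤ᶠ_ : (Ω → Ω) → (Ω → Ω) → Set
f ≤ᶠ g = ∀ p → f p ≤Ω g p

top : Ω → Ω
top (fin zero) = fin zero
top (fin (suc n)) = ω
top ω = ω

data Term : Set where
  var  : ℕ → Term
  _·_  : Term → Term → Term
  _ᵒ   : Term → Term
  _ˡ   : Term → Term
  _ʳ   : Term → Term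
  idT  : Term
  botT : Term

Valuation : Set
Valuation = ℕ → TimeWarp

-- Semantics [[t]]θ, as a relation: Sem θ t f means f = [[t]]θ.
-- Composition/id/⊥/variables are specified pointwise; residuals by
-- their defining universal property among time warps:
--   g ≤ id/f ⇔ g f ≤ id,   g ≤ f\id ⇔ f g ≤ id,   g ≤ ⊤\f ⇔ ⊤ g ≤ f.
data Sem (θ : Valuation) : Term → TimeWarp → Set where
  semVar : ∀ {x} (h : TimeWarp) → (∀ p → fun h p ≡ fun (θ x) p) → Sem θ (var x) h
  semApp : ∀ {t u f g} → Sem θ t f → Sem θ u g →
           (h : TimeWarp) → (∀ p → fun h p ≡ fun f (fun g p)) → Sem θ (t · u) h
  semId  : (h : TimeWarp) → (∀ p → fun h p ≡ p) → Sem θ idT h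
  semBot : (h : TimeWarp) → (∀ p → fun h p ≡ fin 0) → Sem θ botT h
  semL   : ∀ {t f} → Sem θ t f → (h : TimeWarp) →
           (∀ (g : TimeWarp) → (fun g ≤ᶠ fun h) ⇔ ((λ p → fun g (fun f p)) ≤ᶠ (λ p → p))) →
           Sem θ (t ˡ) h
  semR   : ∀ {t f} → Sem θ t f → (h : TimeWarp) →
           (∀ (g : TimeWarp) → (fun g ≤ᶠ fun h) ⇔ ((λ p → fun f (fun g p)) ≤ᶠ (λ p → p))) →
           Sem θ (t ʳ) h
  semO   : ∀ {t f} → Sem θ t f → (h : TimeWarp) →
           (∀ (g : TimeWarp) → (fun g ≤ᶠ fun h) ⇔ ((λ p → top (fun g p)) ≤ᶠ fun f)) →
           Sem θ (t ᵒ) h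

data Sample : Set where
  tv   : ℕ → Sample
  _[_] : Term → Sample → Sample
  s    : Sample → Sample
  p    : Sample → Sample
  last : Term → Sample

infix 4 _⇝_

data _⇝_ : Sample → Sample → Set where
  arg   : ∀ {t α} → t [ α ] ⇝ α
  sarg  : ∀ {α} → s α ⇝ α
  parg  : ∀ {α} → p α ⇝ α
  comp  : ∀ {t u α} → (t · u) [ α ] ⇝ t [ u [ α ] ]
  opp   : ∀ {t α} → (t ᵒ) [ α ] ⇝ t [ α ]
  r1    : ∀ {t α} → (t ʳ) [ α ] ⇝ t [ (t ʳ) [ α ] ]
  r2    : ∀ {t α} → (t ʳ) [ α ] ⇝ t [ s ((t ʳ) [ α ]) ]
  l1    : ∀ {t α} → (t ˡ) [ α ] ⇝ t [ (t ˡ) [ α ] ]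
  l2    : ∀ {t α} → (t ˡ) [ α ] ⇝ t [ p ((t ˡ) [ α ]) ]
  lst   : ∀ {t α} → t [ α ] ⇝ t [ last t ]

data Sat (T : Term → Set) (κ : ℕ) : Sample → Set where
  base : ∀ {t} → T t → Sat T κ (t [ tv κ ])
  step : ∀ {α β} → Sat T κ α → α ⇝ β → Sat T κ β

-- Δ-diagrams.  δ is given as a total map on samples; only its values
-- on Δ matter (every condition requires the samples it mentions to lie in Δ).

record IsDiagram (D : Sample → Set) (δ : Sample → Ω) : Set where
  field
    c1  : ∀ t α β → D α → D β → D (t [ α ]) → D (t [ β ]) →
          δ α ≤Ω δ β → δ (t [ α ]) ≤Ω δ (t [ β ])
    c2  : ∀ t α → D α → D (t [ α ]) → δ α ≡ fin 0 → δ (t [ α ]) ≡ fin 0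
    c3  : ∀ α → D α → D (p α) → δ (p α) ≡ δ α ⊖1
    c4  : ∀ α → D α → D (s α) → δ (s α) ≡ δ α ⊕1
    c5  : ∀ t α → D (t [ α ]) → D α → D (last t) → D (t [ last t ]) →
          (δ (last t) ≤Ω δ α) ⇔ (δ (t [ α ]) ≡ δ (t [ last t ]))
    c6  : ∀ t → D (last t) → D (t [ last t ]) →
          δ (last t) ≡ ω → δ (t [ last t ]) ≡ ω
    c7  : ∀ α → D α → D (idT [ α ]) → δ (idT [ α ]) ≡ δ α
    c8  : ∀ α → D (botT [ α ]) → D (last botT) → δ (last botT) ≡ fin 0
    c9  : ∀ t u α → D ((t · u) [ α ]) → D (t [ u [ α ] ]) →
          δ ((t · u) [ α ]) ≡ δ (t [ u [ α ] ])
    c10 : ∀ t u → D ((t · u) [ last (t · u) ]) → D (last (t · u)) →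
          D (last t) → D (last u) →
          δ (last (t · u)) ≡ ω → δ (last t) ≡ ω × δ (last u) ≡ ω
    c11 : ∀ t α → D ((t ᵒ) [ α ]) → δ ((t ᵒ) [ α ]) ≡ fin 0 ⊎ δ ((t ᵒ) [ α ]) ≡ ω
    c12 : ∀ t α → D α → D ((t ᵒ) [ α ]) → D (t [ α ]) → δ α <Ω ω →
          (δ ((t ᵒ) [ α ]) ≡ ω) ⇔ (δ (t [ α ]) ≡ ω)
    c13 : ∀ t → D (last (t ᵒ)) → δ (last (t ᵒ)) <Ω ω
    c14 : ∀ t α → D (t [ α ]) → D ((t ᵒ) [ last (t ᵒ) ]) → D α →
          δ ((t ᵒ) [ last (t ᵒ) ]) <Ω ω → δ α <Ω ω → δ (t [ α ]) <Ω ω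
    c15 : ∀ t α → D (t [ (t ʳ) [ α ] ]) → D α → δ (t [ (t ʳ) [ α ] ]) ≤Ω δ α
    c16 : ∀ t α → D ((t ʳ) [ α ]) → D α → D (t [ s ((t ʳ) [ α ]) ]) →
          fin 0 <Ω δ α → δ α <Ω ω → δ ((t ʳ) [ α ]) <Ω ω →
          δ α <Ω δ (t [ s ((t ʳ) [ α ]) ])
    c17 : ∀ t → D ((t ʳ) [ last (t ʳ) ]) → D (last (t ʳ)) → D (last t) →
          δ (last (t ʳ)) ≡ ω → δ (last t) ≡ ω
    c18 : ∀ t → D ((t ʳ) [ last (t ʳ) ]) → D (t [ s ((t ʳ) [ last (t ʳ) ]) ]) →
          δ ((t ʳ) [ last (t ʳ) ]) <Ω ω → δ (t [ s ((t ʳ) [ last (t ʳ) ]) ]) ≡ ω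
    c19 : ∀ t α → D (t [ (t ˡ) [ α ] ]) → D ((t ˡ) [ α ]) → D α →
          δ ((t ˡ) [ α ]) <Ω ω → δ α ≤Ω δ (t [ (t ˡ) [ α ] ])
    c20 : ∀ t α → D ((t ˡ) [ α ]) → D α → D (t [ p ((t ˡ) [ α ]) ]) →
          fin 0 <Ω δ α → δ α <Ω ω → δ ((t ˡ) [ α ]) <Ω ω →
          δ (t [ p ((t ˡ) [ α ]) ]) <Ω δ α
    c21 : ∀ t α → D (t [ (t ˡ) [ α ] ]) → D ((t ˡ) [ α ]) → D α →
          δ α <Ω ω → δ ((t ˡ) [ α ]) ≡ ω → δ (t [ (t ˡ) [ α ] ]) <Ω δ α
    c22 : ∀ t → D ((t ˡ) [ last (t ˡ) ]) → D (last (t ˡ)) → D (last t) →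
          δ (last (t ˡ)) ≡ ω → δ (last t) ≡ ω
    c23 : ∀ t → D ((t ˡ) [ last (t ˡ) ]) → D (t [ (t ˡ) [ last (t ˡ) ] ]) →
          δ ((t ˡ) [ last (t ˡ) ]) <Ω ω → δ (t [ (t ˡ) [ last (t ˡ) ] ]) ≡ ω

{-# OPTIONS --safe #-}
-- The diagram is read off the semantics: κ goes to p, t[α] to ⟦t⟧(δ α), s and p to
-- successor and predecessor, and last(t) to the first time at which ⟦t⟧ attains ⟦t⟧(ω).
-- With excluded middle every residual has an explicit first-passage description
-- (id/f: the first time f reaches x; f\id: the first q at which f(q+1) exceeds x;
-- ⊤\f: ω or 0 according as f has reached ω by time x), and each condition on a
-- diagram becomes a property of these formulas, proved by comparing with the
-- minimality of the chosen time.
module Submission where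

open import Defs
open import Level using (0ℓ)
open import Axiom.ExcludedMiddle using (ExcludedMiddle)
open import Data.Nat using (ℕ; zero; suc; z≤n; s≤s) renaming (_<_ to _<ℕ_)
open import Data.Nat.Properties
  using (≤-refl; ≤-trans; ≤-antisym; <⇒≤; <⇒≱; ≤-<-trans; <-≤-trans; ≤-<-connex; 1+n≰n; n≤1+n)
open import Data.Nat.Induction using (<-rec)
open import Data.Product using (Σ; _×_; _,_; proj₁; proj₂)
open import Data.Sum using (_⊎_; inj₁; inj₂)
open import Data.Empty using (⊥-elim)
open import Data.Unit using (⊤; tt)
open import Relation.Nullary using (Dec; yes; no; ¬_)
open import Relation.Binary.PropositionalEquality using (_≡_; refl; sym; trans; cong; subst)
open import Function.Bundles using (_⇔_; mk⇔; Equivalence)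

open Equivalence using (to; from)

≤Ω-refl : ∀ {x} → x ≤Ω x
≤Ω-refl {fin n} = fin≤fin ≤-refl
≤Ω-refl {ω} = ≤ω

≤Ω-trans : ∀ {x y z} → x ≤Ω y → y ≤Ω z → x ≤Ω z
≤Ω-trans (fin≤fin m≤n) (fin≤fin n≤k) = fin≤fin (≤-trans m≤n n≤k)
≤Ω-trans _ ≤ω = ≤ω

≤Ω-antisym : ∀ {x y} → x ≤Ω y → y ≤Ω x → x ≡ y
≤Ω-antisym (fin≤fin m≤n) (fin≤fin n≤m) = cong fin (≤-antisym m≤n n≤m)
≤Ω-antisym ≤ω ≤ω = refl

z≤Ω : ∀ {x} → fin 0 ≤Ω x
z≤Ω {fin n} = fin≤fin z≤n
z≤Ω {ω} = ≤ω

≡0⇒≤Ω : ∀ {x y} → x ≡ fin 0 → x ≤Ω y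
≡0⇒≤Ω refl = z≤Ω

≡ω⇒≥Ω : ∀ {x y} → y ≡ ω → x ≤Ω y
≡ω⇒≥Ω refl = ≤ω

≤Ω0⇒≡0 : ∀ {x} → x ≤Ω fin 0 → x ≡ fin 0
≤Ω0⇒≡0 (fin≤fin z≤n) = refl

ω≤Ω⇒≡ω : ∀ {x} → ω ≤Ω x → x ≡ ω
ω≤Ω⇒≡ω ≤ω = refl

<Ω⇒≤Ω : ∀ {x y} → x <Ω y → x ≤Ω y
<Ω⇒≤Ω (fin<fin m<n) = fin≤fin (<⇒≤ m<n)
<Ω⇒≤Ω fin<ω = ≤ω

<Ω⇒≱Ω : ∀ {x y} → x <Ω y → ¬ y ≤Ω x
<Ω⇒≱Ω (fin<fin m<n) (fin≤fin n≤m) = <⇒≱ m<n n≤m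

<ω⇒≢ω : ∀ {x} → x <Ω ω → ¬ x ≡ ω
<ω⇒≢ω fin<ω ()

≢ω⇒<ω : ∀ {x} → ¬ x ≡ ω → x <Ω ω
≢ω⇒<ω {fin n} _ = fin<ω
≢ω⇒<ω {ω} x≢ω = ⊥-elim (x≢ω refl)

≤fin⇒<ω : ∀ {x n} → x ≤Ω fin n → x <Ω ω
≤fin⇒<ω (fin≤fin _) = fin<ω

≤Ω-<Ω-trans : ∀ {x y z} → x ≤Ω y → y <Ω z → x <Ω z
≤Ω-<Ω-trans (fin≤fin m≤n) (fin<fin n<k) = fin<fin (≤-<-trans m≤n n<k)
≤Ω-<Ω-trans (fin≤fin _) fin<ω = fin<ω

<Ω-≤Ω-trans : ∀ {x y z} → x <Ω y → y ≤Ω z → x <Ω z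
<Ω-≤Ω-trans (fin<fin m<n) (fin≤fin n≤k) = fin<fin (<-≤-trans m<n n≤k)
<Ω-≤Ω-trans (fin<fin _) ≤ω = fin<ω
<Ω-≤Ω-trans fin<ω ≤ω = fin<ω

≤Ω-<Ω-connex : ∀ x y → x ≤Ω y ⊎ y <Ω x
≤Ω-<Ω-connex (fin m) (fin n) with ≤-<-connex m n
... | inj₁ m≤n = inj₁ (fin≤fin m≤n)
... | inj₂ n<m = inj₂ (fin<fin n<m)
≤Ω-<Ω-connex (fin m) ω = inj₁ ≤ω
≤Ω-<Ω-connex ω (fin n) = inj₂ fin<ω
≤Ω-<Ω-connex ω ω = inj₁ ≤ω

≮Ω⇒≥Ω : ∀ {x y} → ¬ x <Ω y → y ≤Ω x
≮Ω⇒≥Ω {x} {y} x≮y with ≤Ω-<Ω-connex y x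
... | inj₁ y≤x = y≤x
... | inj₂ x<y = ⊥-elim (x≮y x<y)

≰Ω⇒>Ω : ∀ {x y} → ¬ x ≤Ω y → y <Ω x
≰Ω⇒>Ω {x} {y} x≰y with ≤Ω-<Ω-connex x y
... | inj₁ x≤y = ⊥-elim (x≰y x≤y)
... | inj₂ y<x = y<x

1+n≰Ωn : ∀ {n} → ¬ fin (suc n) ≤Ω fin n
1+n≰Ωn (fin≤fin 1+n≤n) = 1+n≰n 1+n≤n

<Ω1+n⇒≤Ωn : ∀ {x n} → x <Ω fin (suc n) → x ≤Ω fin n
<Ω1+n⇒≤Ωn (fin<fin (s≤s m≤n)) = fin≤fin m≤n

<Ω⇒1+≤Ω : ∀ {n x} → fin n <Ω x → fin (suc n) ≤Ω x
<Ω⇒1+≤Ω (fin<fin n<m) = fin≤fin n<m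
<Ω⇒1+≤Ω fin<ω = ≤ω

⊕1-mono : ∀ {x y} → x ≤Ω y → x ⊕1 ≤Ω y ⊕1
⊕1-mono (fin≤fin m≤n) = fin≤fin (s≤s m≤n)
⊕1-mono ≤ω = ≤ω

≤Ω-byFiniteBounds : ∀ {x y} → (∀ n → y ≤Ω fin n → x ≤Ω fin n) → x ≤Ω y
≤Ω-byFiniteBounds {y = fin m} bounds = bounds m ≤Ω-refl
≤Ω-byFiniteBounds {y = ω} _ = ≤ω

unbounded⇒≡ω : ∀ {x} → (∀ n → fin n ≤Ω x) → x ≡ ω
unbounded⇒≡ω {fin m} bounds = ⊥-elim (1+n≰Ωn (bounds (suc m)))
unbounded⇒≡ω {ω} _ = refl

top-0⊎ω : ∀ x → x ≡ fin 0 ⊎ top x ≡ ω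
top-0⊎ω (fin zero) = inj₁ refl
top-0⊎ω (fin (suc n)) = inj₂ refl
top-0⊎ω ω = inj₂ refl

indicator : {A : Set} → Dec A → Ω
indicator (yes _) = ω
indicator (no _) = fin 0

indicator≡ω⇔ : {A : Set} (d : Dec A) → indicator d ≡ ω ⇔ A
indicator≡ω⇔ (yes a) = mk⇔ (λ _ → a) (λ _ → refl)
indicator≡ω⇔ (no ¬a) = mk⇔ (λ ()) (λ a → ⊥-elim (¬a a))

indicator-0⊎ω : {A : Set} (d : Dec A) → indicator d ≡ fin 0 ⊎ indicator d ≡ ω
indicator-0⊎ω (yes _) = inj₂ refl
indicator-0⊎ω (no _) = inj₁ refl

UpwardClosed : (Ω → Set) → Set
UpwardClosed P = ∀ {x y} → x ≤Ω y → P x → P y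

data Least (P : Ω → Set) : Ω → Set where
  least : ∀ {m} → P (fin m) → (∀ {k} → k <ℕ m → ¬ P (fin k)) → Least P (fin m)
  none  : (∀ n → ¬ P (fin n)) → Least P ω

module _ {P : Ω → Set} where

  Least-holds : ∀ {x} → Least P x → x <Ω ω → P x
  Least-holds (least Pm _) _ = Pm

  Least-none : ∀ {x} → Least P x → x ≡ ω → ∀ n → ¬ P (fin n)
  Least-none (none ¬P) refl = ¬P

  Least-≡ω : ∀ {x} → Least P x → (∀ n → ¬ P (fin n)) → x ≡ ω
  Least-≡ω (least Pm _) ¬P = ⊥-elim (¬P _ Pm)
  Least-≡ω (none _) _ = refl

  Least-≡0 : ∀ {x} → Least P x → P (fin 0) → x ≡ fin 0
  Least-≡0 (least {zero} _ _) _ = refl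
  Least-≡0 (least {suc m} _ minimal) P0 = ⊥-elim (minimal (s≤s z≤n) P0)
  Least-≡0 (none ¬P) P0 = ⊥-elim (¬P 0 P0)

  Least-≤⇔ : UpwardClosed P → ∀ {x} → Least P x → ∀ n → x ≤Ω fin n ⇔ P (fin n)
  Least-≤⇔ up (least Pm minimal) n =
    mk⇔ (λ m≤n → up m≤n Pm) (λ Pn → ≮Ω⇒≥Ω λ { (fin<fin n<m) → minimal n<m Pn })
  Least-≤⇔ up (none ¬P) n = mk⇔ (λ ()) (λ Pn → ⊥-elim (¬P n Pn))

ReachesωInLimit : TimeWarp → Set
ReachesωInLimit f = fun f ω ≡ ω × (∀ n → fun f (fin n) <Ω ω)

sup-<fin : (f : TimeWarp) → ∀ {a} → (∀ n → fun f (fin n) <Ω fin a) → fun f ω <Ω fin a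
sup-<fin f {zero} below with subst (_<Ω fin 0) (zero0 f) (below 0)
... | fin<fin ()
sup-<fin f {suc a} below =
  ≤Ω-<Ω-trans (supLeast f (fin a) λ n → <Ω1+n⇒≤Ωn (below n)) (fin<fin ≤-refl)

idWarp : TimeWarp
idWarp = record
  { fun = λ x → x ; mono = λ x≤y → x≤y ; zero0 = refl ; supUB = λ _ → ≤ω
  ; supLeast = λ _ bounds → ≡ω⇒≥Ω (unbounded⇒≡ω bounds) }

botWarp : TimeWarp
botWarp = record
  { fun = λ _ → fin 0 ; mono = λ _ → ≤Ω-refl ; zero0 = refl ; supUB = λ _ → ≤Ω-refl
  ; supLeast = λ _ bounds → bounds 0 }

module Classical (em : ExcludedMiddle 0ℓ) where

  leastΩ : (P : Ω → Set) → Σ Ω (Least P)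
  leastΩ P with em {Σ ℕ λ n → P (fin n)}
  ... | no ¬any = ω , none (λ n Pn → ¬any (n , Pn))
  ... | yes (n , Pn) = fin _ , proj₂ (<-rec LeastBelow leastBelow n Pn)
    where
    LeastBelow : ℕ → Set
    LeastBelow n = P (fin n) → Σ ℕ λ m → Least P (fin m)

    leastBelow : ∀ n → (∀ {k} → k <ℕ n → LeastBelow k) → LeastBelow n
    leastBelow n rec Pn with em {Σ ℕ λ k → k <ℕ n × P (fin k)}
    ... | yes (k , k<n , Pk) = rec k<n Pk
    ... | no ¬smaller = n , least Pn (λ k<n Pk → ¬smaller (_ , k<n , Pk))

  cofinal : (f : TimeWarp) → ∀ m → fin m ≤Ω fun f ω → Σ ℕ λ n → fin m ≤Ω fun f (fin n)
  cofinal f zero _ = 0 , z≤Ω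
  cofinal f (suc m) m<fω with em {Σ ℕ λ n → fin (suc m) ≤Ω fun f (fin n)}
  ... | yes reached = reached
  ... | no ¬reached = ⊥-elim (1+n≰Ωn (≤Ω-trans m<fω (supLeast f (fin m) below)))
    where
    below : ∀ n → fun f (fin n) ≤Ω fin m
    below n = <Ω1+n⇒≤Ωn (≰Ω⇒>Ω λ reached → ¬reached (n , reached))

  attained : (f : TimeWarp) → ∀ {k} → fun f ω ≡ fin k → Σ ℕ λ n → fun f (fin n) ≡ fin k
  attained f {k} fω≡k with cofinal f k (subst (fin k ≤Ω_) (sym fω≡k) ≤Ω-refl)
  ... | n , k≤fn = n , ≤Ω-antisym (subst (fun f (fin n) ≤Ω_) fω≡k (supUB f n)) k≤fn

  unattained⇒≡ω : (f : TimeWarp) → (∀ n → ¬ fun f (fin n) ≡ fun f ω) → fun f ω ≡ ω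
  unattained⇒≡ω f unattained with fun f ω in eq
  ... | ω = refl
  ... | fin k = let n , fn≡k = attained f eq in ⊥-elim (unattained n fn≡k)

  module _ (f : TimeWarp) where

    HasFinalValue : Ω → Set
    HasFinalValue x = fun f x ≡ fun f ω

    lastPoint : Ω
    lastPoint = proj₁ (leastΩ HasFinalValue)

    lastPoint-least : Least HasFinalValue lastPoint
    lastPoint-least = proj₂ (leastΩ HasFinalValue)

    hasFinalValue-upward : UpwardClosed HasFinalValue
    hasFinalValue-upward {y = y} x≤y fx≡fω =
      ≤Ω-antisym (mono f ≤ω) (subst (_≤Ω fun f y) fx≡fω (mono f x≤y))

    lastPoint-≤⇔ : ∀ x → lastPoint ≤Ω x ⇔ HasFinalValue x
    lastPoint-≤⇔ (fin n) = Least-≤⇔ hasFinalValue-upward lastPoint-least n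
    lastPoint-≤⇔ ω = mk⇔ (λ _ → refl) (λ _ → ≤ω)

    lastPoint-value : fun f lastPoint ≡ fun f ω
    lastPoint-value = to (lastPoint-≤⇔ lastPoint) ≤Ω-refl

    lastPoint-≤⇔-value : ∀ x → lastPoint ≤Ω x ⇔ fun f x ≡ fun f lastPoint
    lastPoint-≤⇔-value x = mk⇔
      (λ last≤x → trans (to (lastPoint-≤⇔ x) last≤x) (sym lastPoint-value))
      (λ fx≡flast → from (lastPoint-≤⇔ x) (trans fx≡flast lastPoint-value))

    lastPoint≡ω⇔ : lastPoint ≡ ω ⇔ ReachesωInLimit f
    lastPoint≡ω⇔ = mk⇔ inLimit λ (fω≡ω , fn<ω) → Least-≡ω lastPoint-least λ n fn≡fω →
      <ω⇒≢ω (fn<ω n) (trans fn≡fω fω≡ω)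
      where
      inLimit : lastPoint ≡ ω → ReachesωInLimit f
      inLimit last≡ω = fω≡ω , λ n → ≢ω⇒<ω λ fn≡ω → neverFinal n (trans fn≡ω (sym fω≡ω))
        where
        neverFinal : ∀ n → ¬ HasFinalValue (fin n)
        neverFinal = Least-none lastPoint-least last≡ω

        fω≡ω : fun f ω ≡ ω
        fω≡ω = unattained⇒≡ω f neverFinal

    lastPoint≡ω⇒value≡ω : lastPoint ≡ ω → fun f lastPoint ≡ ω
    lastPoint≡ω⇒value≡ω last≡ω = trans lastPoint-value (proj₁ (to lastPoint≡ω⇔ last≡ω))

  ∘-supLeast : (f g : TimeWarp) → ∀ q →
               (∀ n → fun f (fun g (fin n)) ≤Ω q) → fun f (fun g ω) ≤Ω q
  ∘-supLeast f g q bounds with fun g ω in eq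
  ... | fin k = let n , gn≡k = attained g eq in subst (λ y → fun f y ≤Ω q) gn≡k (bounds n)
  ... | ω = supLeast f q λ m →
    let n , m≤gn = cofinal g m (≡ω⇒≥Ω eq) in ≤Ω-trans (mono f m≤gn) (bounds n)

  _∘W_ : TimeWarp → TimeWarp → TimeWarp
  f ∘W g = record
    { fun = λ x → fun f (fun g x)
    ; mono = λ x≤y → mono f (mono g x≤y)
    ; zero0 = trans (cong (fun f) (zero0 g)) (zero0 f)
    ; supUB = λ n → mono f (supUB g n)
    ; supLeast = ∘-supLeast f g }

  ∘-reachesωInLimit : ∀ f g → ReachesωInLimit (f ∘W g) → ReachesωInLimit f × ReachesωInLimit g
  ∘-reachesωInLimit f g (fgω≡ω , fgn<ω) = (fω≡ω , fn<ω) , (gω≡ω , gn<ω)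
    where
    gω≡ω : fun g ω ≡ ω
    gω≡ω = unattained⇒≡ω g λ n gn≡gω →
      <ω⇒≢ω (fgn<ω n) (trans (cong (fun f) gn≡gω) fgω≡ω)

    gn<ω : ∀ n → fun g (fin n) <Ω ω
    gn<ω n = ≢ω⇒<ω λ gn≡ω →
      <ω⇒≢ω (fgn<ω n) (trans (cong (fun f) (trans gn≡ω (sym gω≡ω))) fgω≡ω)

    fω≡ω : fun f ω ≡ ω
    fω≡ω = trans (cong (fun f) (sym gω≡ω)) fgω≡ω

    fn<ω : ∀ n → fun f (fin n) <Ω ω
    fn<ω n = let m , n≤gm = cofinal g n (≡ω⇒≥Ω gω≡ω)
             in ≤Ω-<Ω-trans (mono f n≤gm) (fgn<ω m)

  ∘-lastPoint≡ω : ∀ f g → lastPoint (f ∘W g) ≡ ω → lastPoint f ≡ ω × lastPoint g ≡ ω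
  ∘-lastPoint≡ω f g last≡ω =
    let fω , gω = ∘-reachesωInLimit f g (to (lastPoint≡ω⇔ (f ∘W g)) last≡ω)
    in from (lastPoint≡ω⇔ f) fω , from (lastPoint≡ω⇔ g) gω

  module LeftResidual (f : TimeWarp) where

    Reaches : Ω → Ω → Set
    Reaches x y = x ≤Ω fun f y

    L : Ω → Ω
    L x = proj₁ (leastΩ (Reaches x))

    L-least : ∀ x → Least (Reaches x) (L x)
    L-least x = proj₂ (leastΩ (Reaches x))

    L-≤⇔ : ∀ x n → L x ≤Ω fin n ⇔ x ≤Ω fun f (fin n)
    L-≤⇔ x = Least-≤⇔ (λ y≤z x≤fy → ≤Ω-trans x≤fy (mono f y≤z)) (L-least x)

    L-mono : ∀ {x y} → x ≤Ω y → L x ≤Ω L y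
    L-mono {x} {y} x≤y = ≤Ω-byFiniteBounds λ n Ly≤n →
      from (L-≤⇔ x n) (≤Ω-trans x≤y (to (L-≤⇔ y n) Ly≤n))

    L-supLeast : ∀ q → (∀ n → L (fin n) ≤Ω q) → L ω ≤Ω q
    L-supLeast (fin m) bounds =
      from (L-≤⇔ ω m) (≡ω⇒≥Ω (unbounded⇒≡ω λ n → to (L-≤⇔ (fin n) m) (bounds n)))
    L-supLeast ω _ = ≤ω

    warp : TimeWarp
    warp = record
      { fun = L ; mono = L-mono ; zero0 = Least-≡0 (L-least (fin 0)) z≤Ω
      ; supUB = λ _ → L-mono ≤ω ; supLeast = L-supLeast }

    L-counit : ∀ x → L (fun f x) ≤Ω x
    L-counit (fin n) = from (L-≤⇔ (fun f (fin n)) n) ≤Ω-refl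
    L-counit ω = ≤ω

    universal : ∀ g → (fun g ≤ᶠ L) ⇔ ((λ x → fun g (fun f x)) ≤ᶠ (λ x → x))
    universal g = mk⇔
      (λ g≤L x → ≤Ω-trans (g≤L (fun f x)) (L-counit x))
      (λ gf≤id x → ≤Ω-byFiniteBounds λ n Lx≤n →
        ≤Ω-trans (mono g (to (L-≤⇔ x n) Lx≤n)) (gf≤id (fin n)))

    L-reaches : ∀ x → L x <Ω ω → x ≤Ω fun f (L x)
    L-reaches x = Least-holds (L-least x)

    L-pred-below : ∀ x → fin 0 <Ω x → L x <Ω ω → fun f (L x ⊖1) <Ω x
    L-pred-below x 0<x = go (L-least x)
      where
      go : ∀ {y} → Least (Reaches x) y → y <Ω ω → fun f (y ⊖1) <Ω x
      go (least {zero} _ _) _ = subst (_<Ω x) (sym (zero0 f)) 0<x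
      go (least {suc m} _ minimal) _ = ≰Ω⇒>Ω (minimal ≤-refl)

    L≡ω-below : ∀ x → x <Ω ω → L x ≡ ω → fun f (L x) <Ω x
    L≡ω-below (fin a) _ Lx≡ω = subst (λ y → fun f y <Ω fin a) (sym Lx≡ω)
      (sup-<fin f λ n → ≰Ω⇒>Ω (Least-none (L-least (fin a)) Lx≡ω n))

    aboveSup⇒L≡ω : ∀ {x} → fun f ω <Ω x → L x ≡ ω
    aboveSup⇒L≡ω {x} fω<x = Least-≡ω (L-least x) λ n x≤fn →
      <Ω⇒≱Ω fω<x (≤Ω-trans x≤fn (supUB f n))

    reachesωInLimit : ReachesωInLimit warp → ReachesωInLimit f
    reachesωInLimit (Lω≡ω , Ln<ω) = fω≡ω , fn<ω
      where
      fω≡ω : fun f ω ≡ ω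
      fω≡ω with fun f ω in eq
      ... | ω = refl
      ... | fin j = ⊥-elim (<ω⇒≢ω (Ln<ω (suc j))
                      (aboveSup⇒L≡ω (subst (_<Ω fin (suc j)) (sym eq) (fin<fin ≤-refl))))

      fn<ω : ∀ n → fun f (fin n) <Ω ω
      fn<ω n = ≢ω⇒<ω λ fn≡ω → <ω⇒≢ω (≤fin⇒<ω (from (L-≤⇔ ω n) (≡ω⇒≥Ω fn≡ω))) Lω≡ω

    lastPoint≡ω : lastPoint warp ≡ ω → lastPoint f ≡ ω
    lastPoint≡ω last≡ω =
      from (lastPoint≡ω⇔ f) (reachesωInLimit (to (lastPoint≡ω⇔ warp) last≡ω))

    lastPoint-reaches : L (lastPoint warp) <Ω ω → fun f (L (lastPoint warp)) ≡ ω
    lastPoint-reaches L-last<ω = ω≤Ω⇒≡ω (subst (λ y → ω ≤Ω fun f y) (sym (lastPoint-value warp))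
      (L-reaches ω (subst (_<Ω ω) (lastPoint-value warp) L-last<ω)))

  -- The clauses at 0 and ω make R below a time warp: R 0 = 0, and R ω is the supremum of the R n.
  Beyond : Ω → Ω → Set
  Beyond (fin zero) y = ⊤
  Beyond (fin (suc n)) y = fin (suc n) <Ω y
  Beyond ω y = y ≡ ω

  Beyond-upward : ∀ {x y z} → y ≤Ω z → Beyond x y → Beyond x z
  Beyond-upward {fin zero} _ _ = tt
  Beyond-upward {fin (suc n)} y≤z n<y = <Ω-≤Ω-trans n<y y≤z
  Beyond-upward {ω} y≤z refl = ω≤Ω⇒≡ω y≤z

  Beyond-antitone : ∀ {x x′ y} → x ≤Ω x′ → Beyond x′ y → Beyond x y
  Beyond-antitone {fin zero} _ _ = tt
  Beyond-antitone {fin (suc n)} {fin zero} (fin≤fin ()) _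
  Beyond-antitone {fin (suc n)} {fin (suc n′)} n≤n′ n′<y = ≤Ω-<Ω-trans n≤n′ n′<y
  Beyond-antitone {fin (suc n)} {ω} _ refl = fin<ω
  Beyond-antitone {ω} {ω} _ y≡ω = y≡ω

  ¬Beyond⇒≤ : ∀ {x y} → ¬ Beyond x y → y ≤Ω x
  ¬Beyond⇒≤ {fin zero} ¬beyond = ⊥-elim (¬beyond tt)
  ¬Beyond⇒≤ {fin (suc n)} ¬beyond = ≮Ω⇒≥Ω ¬beyond
  ¬Beyond⇒≤ {ω} _ = ≤ω

  <⇒¬Beyond : ∀ {x y} → y <Ω x → ¬ Beyond x y
  <⇒¬Beyond {fin zero} (fin<fin ())
  <⇒¬Beyond {fin (suc n)} y<x n<y = <Ω⇒≱Ω n<y (<Ω⇒≤Ω y<x)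
  <⇒¬Beyond {ω} y<ω y≡ω = <ω⇒≢ω y<ω y≡ω

  module RightResidual (f : TimeWarp) where

    StepsBeyond : Ω → Ω → Set
    StepsBeyond x y = Beyond x (fun f (y ⊕1))

    R : Ω → Ω
    R x = proj₁ (leastΩ (StepsBeyond x))

    R-least : ∀ x → Least (StepsBeyond x) (R x)
    R-least x = proj₂ (leastΩ (StepsBeyond x))

    R-≤⇔ : ∀ x n → R x ≤Ω fin n ⇔ Beyond x (fun f (fin (suc n)))
    R-≤⇔ x = Least-≤⇔ (λ y≤z → Beyond-upward (mono f (⊕1-mono y≤z))) (R-least x)

    R-mono : ∀ {x y} → x ≤Ω y → R x ≤Ω R y
    R-mono {x} {y} x≤y = ≤Ω-byFiniteBounds λ n Ry≤n →
      from (R-≤⇔ x n) (Beyond-antitone x≤y (to (R-≤⇔ y n) Ry≤n))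

    R-supLeast : ∀ q → (∀ n → R (fin n) ≤Ω q) → R ω ≤Ω q
    R-supLeast (fin m) bounds = from (R-≤⇔ ω m) (unbounded⇒≡ω λ k →
      <Ω⇒≤Ω (≤Ω-<Ω-trans (fin≤fin (n≤1+n k)) (to (R-≤⇔ (fin (suc k)) m) (bounds (suc k)))))
    R-supLeast ω _ = ≤ω

    warp : TimeWarp
    warp = record
      { fun = R ; mono = R-mono ; zero0 = Least-≡0 (R-least (fin 0)) tt
      ; supUB = λ _ → R-mono ≤ω ; supLeast = R-supLeast }

    R-counit : ∀ x → fun f (R x) ≤Ω x
    R-counit x = go (R-least x)
      where
      go : ∀ {y} → Least (StepsBeyond x) y → fun f y ≤Ω x
      go (least {zero} _ _) = ≡0⇒≤Ω (zero0 f)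
      go (least {suc m} _ minimal) = ¬Beyond⇒≤ (minimal ≤-refl)
      go (none ¬beyond) = supLeast f x λ where
        zero → ≡0⇒≤Ω (zero0 f)
        (suc n) → ¬Beyond⇒≤ (¬beyond n)

    universal-fin : ∀ g → ((λ x → fun f (fun g x)) ≤ᶠ (λ x → x)) →
                    ∀ m → fun g (fin m) ≤Ω R (fin m)
    universal-fin g fg≤id zero = ≡0⇒≤Ω (zero0 g)
    universal-fin g fg≤id (suc k) = ≤Ω-byFiniteBounds λ n R≤n → ≮Ω⇒≥Ω λ n<g →
      <Ω⇒≱Ω (to (R-≤⇔ (fin (suc k)) n) R≤n)
        (≤Ω-trans (mono f (<Ω⇒1+≤Ω n<g)) (fg≤id (fin (suc k))))

    universal : ∀ g → (fun g ≤ᶠ R) ⇔ ((λ x → fun f (fun g x)) ≤ᶠ (λ x → x))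
    universal g = mk⇔
      (λ g≤R x → ≤Ω-trans (mono f (g≤R x)) (R-counit x))
      (λ { fg≤id (fin m) → universal-fin g fg≤id m
         ; fg≤id ω → supLeast g (R ω) λ n → ≤Ω-trans (universal-fin g fg≤id n) (R-mono ≤ω) })

    R-beyond : ∀ x → R x <Ω ω → Beyond x (fun f (R x ⊕1))
    R-beyond x = Least-holds (R-least x)

    R-exceeds : ∀ x → fin 0 <Ω x → x <Ω ω → R x <Ω ω → x <Ω fun f (R x ⊕1)
    R-exceeds (fin zero) (fin<fin ())
    R-exceeds (fin (suc n)) _ _ = R-beyond (fin (suc n))

    aboveSup⇒R≡ω : ∀ {x} → fun f ω <Ω x → R x ≡ ω
    aboveSup⇒R≡ω {x} fω<x = Least-≡ω (R-least x) λ n →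
      <⇒¬Beyond (≤Ω-<Ω-trans (supUB f (suc n)) fω<x)

    reachesωInLimit : ReachesωInLimit warp → ReachesωInLimit f
    reachesωInLimit (Rω≡ω , Rn<ω) = fω≡ω , fn<ω
      where
      fω≡ω : fun f ω ≡ ω
      fω≡ω with fun f ω in eq
      ... | ω = refl
      ... | fin j = ⊥-elim (<ω⇒≢ω (Rn<ω (suc j))
                      (aboveSup⇒R≡ω (subst (_<Ω fin (suc j)) (sym eq) (fin<fin ≤-refl))))

      fn<ω : ∀ n → fun f (fin n) <Ω ω
      fn<ω n = ≢ω⇒<ω λ fn≡ω → <ω⇒≢ω (≤fin⇒<ω (from (R-≤⇔ ω n)
        (ω≤Ω⇒≡ω (subst (_≤Ω fun f (fin (suc n))) fn≡ω (mono f (fin≤fin (n≤1+n n))))))) Rω≡ω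

    lastPoint≡ω : lastPoint warp ≡ ω → lastPoint f ≡ ω
    lastPoint≡ω last≡ω =
      from (lastPoint≡ω⇔ f) (reachesωInLimit (to (lastPoint≡ω⇔ warp) last≡ω))

    lastPoint-beyond : R (lastPoint warp) <Ω ω → fun f (R (lastPoint warp) ⊕1) ≡ ω
    lastPoint-beyond R-last<ω = subst (λ y → fun f (y ⊕1) ≡ ω) (sym (lastPoint-value warp))
      (R-beyond ω (subst (_<Ω ω) (lastPoint-value warp) R-last<ω))

  module TopResidual (f : TimeWarp) where

    ReachesωBy : Ω → Set
    ReachesωBy (fin n) = fun f (fin n) ≡ ω
    ReachesωBy ω = Σ ℕ λ n → fun f (fin n) ≡ ω

    reachesωBy-mono : ∀ {x y} → x ≤Ω y → ReachesωBy x → ReachesωBy y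
    reachesωBy-mono {fin n} {fin m} n≤m fn≡ω =
      ω≤Ω⇒≡ω (subst (_≤Ω fun f (fin m)) fn≡ω (mono f n≤m))
    reachesωBy-mono {fin n} {ω} _ fn≡ω = n , fn≡ω
    reachesωBy-mono {ω} {ω} _ reached = reached

    reachesωBy⇒≡ω : ∀ x → ReachesωBy x → fun f x ≡ ω
    reachesωBy⇒≡ω (fin n) fn≡ω = fn≡ω
    reachesωBy⇒≡ω ω (n , fn≡ω) = ω≤Ω⇒≡ω (subst (_≤Ω fun f ω) fn≡ω (supUB f n))

    O : Ω → Ω
    O x = indicator (em {ReachesωBy x})

    O≡ω⇔ : ∀ x → O x ≡ ω ⇔ ReachesωBy x
    O≡ω⇔ x = indicator≡ω⇔ (em {ReachesωBy x})

    O-0⊎ω : ∀ x → O x ≡ fin 0 ⊎ O x ≡ ω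
    O-0⊎ω x = indicator-0⊎ω (em {ReachesωBy x})

    O-mono : ∀ {x y} → x ≤Ω y → O x ≤Ω O y
    O-mono {x} {y} x≤y with O-0⊎ω x
    ... | inj₁ Ox≡0 = ≡0⇒≤Ω Ox≡0
    ... | inj₂ Ox≡ω = ≡ω⇒≥Ω (from (O≡ω⇔ y) (reachesωBy-mono x≤y (to (O≡ω⇔ x) Ox≡ω)))

    O-zero : O (fin 0) ≡ fin 0
    O-zero with O-0⊎ω (fin 0)
    ... | inj₁ O0≡0 = O0≡0
    ... | inj₂ O0≡ω with trans (sym (zero0 f)) (to (O≡ω⇔ (fin 0)) O0≡ω)
    ...   | ()

    O-supLeast : ∀ q → (∀ n → O (fin n) ≤Ω q) → O ω ≤Ω q
    O-supLeast q bounds with O-0⊎ω ω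
    ... | inj₁ Oω≡0 = ≡0⇒≤Ω Oω≡0
    ... | inj₂ Oω≡ω = let n , fn≡ω = to (O≡ω⇔ ω) Oω≡ω in
      ≡ω⇒≥Ω (ω≤Ω⇒≡ω (subst (_≤Ω q) (from (O≡ω⇔ (fin n)) fn≡ω) (bounds n)))

    warp : TimeWarp
    warp = record
      { fun = O ; mono = O-mono ; zero0 = O-zero ; supUB = λ _ → O-mono ≤ω
      ; supLeast = O-supLeast }

    universal : ∀ g → (fun g ≤ᶠ O) ⇔ ((λ x → top (fun g x)) ≤ᶠ fun f)
    universal g = mk⇔ ⊤g≤f g≤O
      where
      ⊤g≤f : fun g ≤ᶠ O → (λ x → top (fun g x)) ≤ᶠ fun f
      ⊤g≤f g≤O x with O-0⊎ω x
      ... | inj₁ Ox≡0 = subst (λ y → top y ≤Ω fun f x)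
                          (sym (≤Ω0⇒≡0 (subst (fun g x ≤Ω_) Ox≡0 (g≤O x)))) z≤Ω
      ... | inj₂ Ox≡ω = ≡ω⇒≥Ω (reachesωBy⇒≡ω x (to (O≡ω⇔ x) Ox≡ω))

      g≤O-fin : (λ x → top (fun g x)) ≤ᶠ fun f → ∀ n → fun g (fin n) ≤Ω O (fin n)
      g≤O-fin ⊤g≤f n with top-0⊎ω (fun g (fin n))
      ... | inj₁ gn≡0 = ≡0⇒≤Ω gn≡0
      ... | inj₂ ⊤gn≡ω = ≡ω⇒≥Ω (from (O≡ω⇔ (fin n))
                           (ω≤Ω⇒≡ω (subst (_≤Ω fun f (fin n)) ⊤gn≡ω (⊤g≤f (fin n)))))

      g≤O : (λ x → top (fun g x)) ≤ᶠ fun f → fun g ≤ᶠ O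
      g≤O ⊤g≤f (fin n) = g≤O-fin ⊤g≤f n
      g≤O ⊤g≤f ω = supLeast g (O ω) λ n → ≤Ω-trans (g≤O-fin ⊤g≤f n) (O-mono ≤ω)

    O-fin≡ω⇔ : ∀ x → x <Ω ω → O x ≡ ω ⇔ fun f x ≡ ω
    O-fin≡ω⇔ (fin n) _ = O≡ω⇔ (fin n)

    lastPoint<ω : lastPoint warp <Ω ω
    lastPoint<ω with O-0⊎ω ω
    ... | inj₁ Oω≡0 = ≤fin⇒<ω (from (lastPoint-≤⇔ warp (fin 0)) (trans O-zero (sym Oω≡0)))
    ... | inj₂ Oω≡ω = let n , fn≡ω = to (O≡ω⇔ ω) Oω≡ω in
      ≤fin⇒<ω (from (lastPoint-≤⇔ warp (fin n)) (trans (from (O≡ω⇔ (fin n)) fn≡ω) (sym Oω≡ω)))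

    O-lastPoint<ω⇒<ω : ∀ x → O (lastPoint warp) <Ω ω → x <Ω ω → fun f x <Ω ω
    O-lastPoint<ω⇒<ω (fin n) O-last<ω _ = ≢ω⇒<ω λ fn≡ω →
      <ω⇒≢ω (subst (_<Ω ω) (lastPoint-value warp) O-last<ω) (from (O≡ω⇔ ω) (n , fn≡ω))

module Interpretation (em : ExcludedMiddle 0ℓ) (θ : Valuation) where

  open Classical em

  ⟦_⟧ : Term → TimeWarp
  ⟦ var x ⟧ = θ x
  ⟦ t · u ⟧ = ⟦ t ⟧ ∘W ⟦ u ⟧
  ⟦ t ᵒ ⟧ = TopResidual.warp ⟦ t ⟧
  ⟦ t ˡ ⟧ = LeftResidual.warp ⟦ t ⟧
  ⟦ t ʳ ⟧ = RightResidual.warp ⟦ t ⟧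
  ⟦ idT ⟧ = idWarp
  ⟦ botT ⟧ = botWarp

  ⟦⟧-sem : ∀ t → Sem θ t ⟦ t ⟧
  ⟦⟧-sem (var x) = semVar (θ x) (λ _ → refl)
  ⟦⟧-sem (t · u) = semApp (⟦⟧-sem t) (⟦⟧-sem u) _ (λ _ → refl)
  ⟦⟧-sem (t ᵒ) = semO (⟦⟧-sem t) _ (TopResidual.universal ⟦ t ⟧)
  ⟦⟧-sem (t ˡ) = semL (⟦⟧-sem t) _ (LeftResidual.universal ⟦ t ⟧)
  ⟦⟧-sem (t ʳ) = semR (⟦⟧-sem t) _ (RightResidual.universal ⟦ t ⟧)
  ⟦⟧-sem idT = semId _ (λ _ → refl)
  ⟦⟧-sem botT = semBot _ (λ _ → refl)

  δ : Ω → Sample → Ω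
  δ q (tv _) = q
  δ q (t [ α ]) = fun ⟦ t ⟧ (δ q α)
  δ q (s α) = δ q α ⊕1
  δ q (p α) = δ q α ⊖1
  δ q (last t) = lastPoint ⟦ t ⟧

  -- Each condition holds for all samples, so no membership hypothesis is used.
  δ-isDiagram : ∀ q (D : Sample → Set) → IsDiagram D (δ q)
  δ-isDiagram q D = record
    { c1 = λ t _ _ _ _ _ _ → mono ⟦ t ⟧
    ; c2 = λ t _ _ _ α≡0 → trans (cong (fun ⟦ t ⟧) α≡0) (zero0 ⟦ t ⟧)
    ; c3 = λ _ _ _ → refl
    ; c4 = λ _ _ _ → refl
    ; c5 = λ t α _ _ _ _ → lastPoint-≤⇔-value ⟦ t ⟧ (δ q α)
    ; c6 = λ t _ _ → lastPoint≡ω⇒value≡ω ⟦ t ⟧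
    ; c7 = λ _ _ _ → refl
    ; c8 = λ _ _ _ → Least-≡0 (lastPoint-least botWarp) refl
    ; c9 = λ _ _ _ _ _ → refl
    ; c10 = λ t u _ _ _ _ → ∘-lastPoint≡ω ⟦ t ⟧ ⟦ u ⟧
    ; c11 = λ t α _ → TopResidual.O-0⊎ω ⟦ t ⟧ (δ q α)
    ; c12 = λ t α _ _ _ → TopResidual.O-fin≡ω⇔ ⟦ t ⟧ (δ q α)
    ; c13 = λ t _ → TopResidual.lastPoint<ω ⟦ t ⟧
    ; c14 = λ t α _ _ _ → TopResidual.O-lastPoint<ω⇒<ω ⟦ t ⟧ (δ q α)
    ; c15 = λ t α _ _ → RightResidual.R-counit ⟦ t ⟧ (δ q α)
    ; c16 = λ t α _ _ _ → RightResidual.R-exceeds ⟦ t ⟧ (δ q α)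
    ; c17 = λ t _ _ _ → RightResidual.lastPoint≡ω ⟦ t ⟧
    ; c18 = λ t _ _ → RightResidual.lastPoint-beyond ⟦ t ⟧
    ; c19 = λ t α _ _ _ → LeftResidual.L-reaches ⟦ t ⟧ (δ q α)
    ; c20 = λ t α _ _ _ 0<α _ → LeftResidual.L-pred-below ⟦ t ⟧ (δ q α) 0<α
    ; c21 = λ t α _ _ _ → LeftResidual.L≡ω-below ⟦ t ⟧ (δ q α)
    ; c22 = λ t _ _ _ → LeftResidual.lastPoint≡ω ⟦ t ⟧
    ; c23 = λ t _ _ → LeftResidual.lastPoint-reaches ⟦ t ⟧
    }

proposition3p14 : ExcludedMiddle 0ℓ →
    (T : Term → Set) (κ : ℕ) (θ : Valuation) (q : Ω) →
    Σ (Sample → Ω) (λ δ →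
      IsDiagram (Sat T κ) δ × δ (tv κ) ≡ q ×
      ((t : Term) → T t → Σ TimeWarp (λ f → Sem θ t f × δ (t [ tv κ ]) ≡ fun f q)))
proposition3p14 em T κ θ q =
  δ q , δ-isDiagram q (Sat T κ) , refl , λ t _ → ⟦ t ⟧ , ⟦⟧-sem t , refl
  where open Interpretation em θ
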